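{- Let $P$ be a normal logic program and $S$ a nonempty set of two-valued interpretations of $P$. Then among the stable trap spaces $I$ of $P$ with $S\subseteq[I]$ there is a unique $\le_s$-minimal one (denoted $\langle S\rangle^{st}_P$), and among the supported trap spaces $I$ of $P$ with $S\subseteq[I]$ there is a unique $\le_s$-minimal one (denoted $\langle S\rangle^{sp}_P$).
   Context: Fix a first-order language with finitely many constant, function and predicate symbols. A normal logic program (NLP) $P$ is a finite set of rules $p \leftarrow p_1,\dots,p_m, \mathord{\sim} p_{m+1},\dots,\mathord{\sim} p_k$ ($k\ge m\ge 0$). $\mathrm{HB}(P)$ is its Herbrand base (possibly infinite), $\mathrm{gr}(P)$ its ground instantiation; for a ground rule $r$, $B^+(r)$, $B^-(r)$ are the positive and negative body atoms and $\mathrm{bf}(r)=\bigwedge_{v\in B^+(r)}v\wedge\bigwedge_{v\in B^-(r)}\neg v$. A three-valued interpretation is a map $I:\mathrm{HB}(P)\to\{0,1,\star\}$; two-valued ones (no $\star$) are identified with subsets of $\mathrm{HB}(P)$. $[I]=\{J\subseteq\mathrm{HB}(P): \forall a,\ I(a)\ne\star\Rightarrow J(a)=I(a)\}$. $\le_s$ is the pointwise order with $0<_s\star$, $1<_s\star$ only (equivalently $I_1\le_s I_2$ iff $[I_1]\subseteq[I_2]$). For two-valued $I$: $F_P(I)$ is the $\subseteq$-least model of the Gelfond–Lifschitz reduct of $\mathrm{gr}(P)$ w.r.t. $I$ (delete rules with some $b\in B^-(r)\cap I$, then delete remaining negative literals); $T_P(I)$ is the set of atoms $a$ such that $I$ satisfies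 $\mathrm{bf}(r)$ for some $r\in\mathrm{gr}(P)$ with head $a$. A nonempty set $S$ of two-valued interpretations is a stable (resp. supported) trap set if $\{F_P(J):J\in S\}\subseteq S$ (resp. $\{T_P(J):J\in S\}\subseteq S$). A three-valued $I$ is a stable (resp. supported) trap space if $[I]$ is a stable (resp. supported) trap set. -}

module Defs where

open import Level using (Level; _⊔_; Setω) renaming (zero to lzero; suc to lsuc)
open import Data.Nat using (ℕ)
open import Data.Fin using (Fin)
open import Data.Bool using (Bool; true; false)
open import Data.Vec using (Vec; []; _∷_)
open import Data.List using (List; map)
open import Data.List.Membership.Propositional using (_∈_)
open import Data.Product using (Σ; ∃; _×_; _,_)
open import Data.Sum using (_⊎_)
open import Relation.Nullary using (Dec)
open import Relation.Binary.PropositionalEquality using (_≡_)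

-- Classical logic (excluded middle), the metatheory of the paper.
ExcludedMiddle : Setω
ExcludedMiddle = ∀ {ℓ : Level} (A : Set ℓ) → Dec A

record Signature : Set where
  field
    nConst : ℕ
    nFun   : ℕ
    nPred  : ℕ
    funArity  : Fin nFun  → ℕ
    predArity : Fin nPred → ℕ

module _ (L : Signature) where
  open Signature L

  data Term : Set where
    var : ℕ → Term
    con : Fin nConst → Term
    app : (f : Fin nFun) → Vec Term (funArity f) → Term

  data GTerm : Set where
    gcon : Fin nConst → GTerm
    gapp : (f : Fin nFun) → Vec GTerm (funArity f) → GTerm

  record Atom : Set where
    constructor atom
    field
      pred : Fin nPred
      args : Vec Term (predArity pred)

  record GAtom : Set where
    constructor gatom
    field
      pred : Fin nPred
      args : Vec GTerm (predArity pred)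

  record Rule : Set where
    constructor rule
    field
      head : Atom
      pos  : List Atom
      neg  : List Atom

  record GRule : Set where
    constructor grule
    field
      head : GAtom
      pos  : List GAtom
      neg  : List GAtom

  Program : Set
  Program = List Rule

  Subst : Set
  Subst = ℕ → GTerm

  mutual
    substTerm : Subst → Term → GTerm
    substTerm σ (var x)   = σ x
    substTerm σ (con c)   = gcon c
    substTerm σ (app f ts) = gapp f (substTerms σ ts)

    substTerms : ∀ {n} → Subst → Vec Term n → Vec GTerm n
    substTerms σ []       = []
    substTerms σ (t ∷ ts) = substTerm σ t ∷ substTerms σ ts

  substAtom : Subst → Atom → GAtom
  substAtom σ (atom p ts) = gatom p (substTerms σ ts)

  substRule : Subst → Rule → GRule
  substRule σ (rule h ps ns) = grule (substAtom σ h) (map (substAtom σ) ps) (map (substAtom σ) ns)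

  InGround : Program → GRule → Set
  InGround P g = Σ Rule λ r → r ∈ P × Σ Subst λ σ → substRule σ r ≡ g

  -- two-valued interpretations (characteristic functions of subsets of HB(P))
  Interp : Set
  Interp = GAtom → Bool

  InterpSet : Set₁
  InterpSet = Interp → Set

  data V3 : Set where
    v0 v1 ⋆ : V3

  Interp3 : Set
  Interp3 = GAtom → V3

  _∈[_] : Interp → Interp3 → Set
  J ∈[ I ] = ∀ a → (I a ≡ v0 → J a ≡ false) × (I a ≡ v1 → J a ≡ true)

  _≤s_ : Interp3 → Interp3 → Set
  I₁ ≤s I₂ = ∀ a → I₁ a ≡ I₂ a ⊎ I₂ a ≡ ⋆

  _≐_ : Interp3 → Interp3 → Set
  I₁ ≐ I₂ = ∀ a → I₁ a ≡ I₂ a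

  SatBody : Interp → GRule → Set
  SatBody J r = (∀ b → b ∈ GRule.pos r → J b ≡ true) × (∀ b → b ∈ GRule.neg r → J b ≡ false)

  -- K is a model of the Gelfond–Lifschitz reduct of gr(P) w.r.t. J
  ModelOfReduct : Program → Interp → Interp → Set
  ModelOfReduct P J K = ∀ r → InGround P r →
    (∀ b → b ∈ GRule.neg r → J b ≡ false) →
    (∀ b → b ∈ GRule.pos r → K b ≡ true) →
    K (GRule.head r) ≡ true

  IsF : Program → Interp → Interp → Set
  IsF P J K = ModelOfReduct P J K ×
    (∀ K' → ModelOfReduct P J K' → ∀ a → K a ≡ true → K' a ≡ true)

  IsT : Program → Interp → Interp → Set
  IsT P J K = ∀ a →
    (K a ≡ true → Σ GRule λ r → InGround P r × GRule.head r ≡ a × SatBody J r) ×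
    ((Σ GRule λ r → InGround P r × GRule.head r ≡ a × SatBody J r) → K a ≡ true)

  StableTrapSet : Program → InterpSet → Set
  StableTrapSet P S = (Σ Interp S) × (∀ J → S J → ∀ K → IsF P J K → S K)

  SupportedTrapSet : Program → InterpSet → Set
  SupportedTrapSet P S = (Σ Interp S) × (∀ J → S J → ∀ K → IsT P J K → S K)

  ⟦_⟧ : Interp3 → InterpSet
  ⟦ I ⟧ J = J ∈[ I ]

  StableTrapSpace : Program → Interp3 → Set
  StableTrapSpace P I = StableTrapSet P ⟦ I ⟧

  SupportedTrapSpace : Program → Interp3 → Set
  SupportedTrapSpace P I = SupportedTrapSet P ⟦ I ⟧

  IsMinimal : (Interp3 → Set) → Interp3 → Set
  IsMinimal C I = C I × (∀ I' → C I' → I' ≤s I → I' ≐ I)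

  UniqueMinimal : (Interp3 → Set) → Set
  UniqueMinimal C = Σ Interp3 λ I → IsMinimal C I × (∀ I' → IsMinimal C I' → I' ≐ I)

  _⊆[_] : InterpSet → Interp3 → Set
  S ⊆[ I ] = ∀ J → S J → J ∈[ I ]

-- The trap spaces whose box contains S all share a point of S, so no atom is fixed to 0 by one of
-- them and to 1 by another.  Their meet, fixing an atom exactly when some member fixes it, is
-- therefore well defined (deciding "some member fixes it" is where excluded middle enters), its box
-- is the intersection of their boxes, and an intersection of trap sets is a trap set.  So the meet
-- is the least trap space containing S, for the stable and the supported operator alike.
module Submission where

open import Defs
open import Data.Product using (Σ; ∃; _×_; _,_; proj₁; proj₂)
open import Data.Sum using (inj₁; inj₂)
open import Data.Bool using (true; false)
open import Data.Empty using (⊥)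
open import Relation.Nullary using (Dec; yes; no; contradiction)
open import Relation.Binary.PropositionalEquality using (_≡_; refl; sym; trans)

module _ (L : Signature) where

  TrapSet : (Interp L → Interp L → Set) → InterpSet L → Set
  TrapSet Step S = Σ (Interp L) S × (∀ J → S J → ∀ K → Step J K → S K)

  TrapSpace : (Interp L → Interp L → Set) → Interp3 L → Set
  TrapSpace Step I = TrapSet Step (⟦_⟧ L I)

  ≤s-antisym : ∀ {I I'} → _≤s_ L I I' → _≤s_ L I' I → _≐_ L I I'
  ≤s-antisym I≤I' I'≤I a with I≤I' a | I'≤I a
  ... | inj₁ Ia≡I'a | _           = Ia≡I'a
  ... | inj₂ _      | inj₁ I'a≡Ia = sym I'a≡Ia
  ... | inj₂ I'a≡⋆  | inj₂ Ia≡⋆   = trans Ia≡⋆ (sym I'a≡⋆)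

  least⇒uniqueMinimal : (C : Interp3 L → Set) (I : Interp3 L) →
                        C I → (∀ I' → C I' → _≤s_ L I I') → UniqueMinimal L C
  least⇒uniqueMinimal C I CI I≤C =
      I
    , (CI , λ I' CI' I'≤I → ≤s-antisym I'≤I (I≤C I' CI'))
    , λ I' (CI' , minimal) a → sym (minimal I CI (I≤C I' CI') a)

  module Meet (em : ExcludedMiddle) (C : Interp3 L → Set)
              (J₀ : Interp L) (J₀∈C : ∀ I → C I → _∈[_] L J₀ I) where

    Pinned : GAtom L → V3 L → Set
    Pinned a v = ∃ λ I → C I × I a ≡ v

    ¬pinned-v0-and-v1 : ∀ {a} → Pinned a v0 → Pinned a v1 → ⊥
    ¬pinned-v0-and-v1 {a} (I , CI , Ia≡0) (I' , CI' , I'a≡1) =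
      contradiction (trans (sym (proj₁ (J₀∈C I CI a) Ia≡0)) (proj₂ (J₀∈C I' CI' a) I'a≡1)) λ ()

    value : ∀ {a} → Dec (Pinned a v0) → Dec (Pinned a v1) → V3 L
    value (yes _) _       = v0
    value (no _)  (yes _) = v1
    value (no _)  (no _)  = ⋆

    ⋀ : Interp3 L
    ⋀ a = value (em (Pinned a v0)) (em (Pinned a v1))

    ⋀≡v0⇒pinned : ∀ a → ⋀ a ≡ v0 → Pinned a v0
    ⋀≡v0⇒pinned a = go (em _) (em _)
      where
      go : (d₀ : Dec (Pinned a v0)) (d₁ : Dec (Pinned a v1)) → value d₀ d₁ ≡ v0 → Pinned a v0
      go (yes p) _       _  = p
      go (no _)  (yes _) ()
      go (no _)  (no _)  ()

    ⋀≡v1⇒pinned : ∀ a → ⋀ a ≡ v1 → Pinned a v1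
    ⋀≡v1⇒pinned a = go (em _) (em _)
      where
      go : (d₀ : Dec (Pinned a v0)) (d₁ : Dec (Pinned a v1)) → value d₀ d₁ ≡ v1 → Pinned a v1
      go (yes _) _       ()
      go (no _)  (yes p) _  = p
      go (no _)  (no _)  ()

    pinned⇒⋀≡v0 : ∀ a → Pinned a v0 → ⋀ a ≡ v0
    pinned⇒⋀≡v0 a = go (em _) (em _)
      where
      go : (d₀ : Dec (Pinned a v0)) (d₁ : Dec (Pinned a v1)) → Pinned a v0 → value d₀ d₁ ≡ v0
      go (yes _) _ _ = refl
      go (no ¬p) _ p = contradiction p ¬p

    pinned⇒⋀≡v1 : ∀ a → Pinned a v1 → ⋀ a ≡ v1
    pinned⇒⋀≡v1 a = go (em _) (em _)
      where
      go : (d₀ : Dec (Pinned a v0)) (d₁ : Dec (Pinned a v1)) → Pinned a v1 → value d₀ d₁ ≡ v1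
      go (yes p₀) _        p₁ = contradiction p₁ (¬pinned-v0-and-v1 p₀)
      go (no _)   (yes _)  _  = refl
      go (no _)   (no ¬p₁) p₁ = contradiction p₁ ¬p₁

    ∈[⋀]⇒∈[_] : ∀ {J} → _∈[_] L J ⋀ → ∀ I → C I → _∈[_] L J I
    ∈[⋀]⇒∈[_] J∈⋀ I CI a =
        (λ Ia≡0 → proj₁ (J∈⋀ a) (pinned⇒⋀≡v0 a (I , CI , Ia≡0)))
      , (λ Ia≡1 → proj₂ (J∈⋀ a) (pinned⇒⋀≡v1 a (I , CI , Ia≡1)))

    ∈[_]⇒∈[⋀] : ∀ {J : Interp L} → (∀ I → C I → _∈[_] L J I) → _∈[_] L J ⋀
    ∈[_]⇒∈[⋀] {J} J∈C a = fixed-v0 , fixed-v1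
      where
      fixed-v0 : ⋀ a ≡ v0 → J a ≡ false
      fixed-v0 ⋀a≡0 with ⋀≡v0⇒pinned a ⋀a≡0
      ... | I , CI , Ia≡0 = proj₁ (J∈C I CI a) Ia≡0
      fixed-v1 : ⋀ a ≡ v1 → J a ≡ true
      fixed-v1 ⋀a≡1 with ⋀≡v1⇒pinned a ⋀a≡1
      ... | I , CI , Ia≡1 = proj₂ (J∈C I CI a) Ia≡1

    ⋀-≤s : ∀ I → C I → _≤s_ L ⋀ I
    ⋀-≤s I CI a with I a in Ia≡
    ... | v0 = inj₁ (pinned⇒⋀≡v0 a (I , CI , Ia≡))
    ... | v1 = inj₁ (pinned⇒⋀≡v1 a (I , CI , Ia≡))
    ... | ⋆  = inj₂ refl

    ⋀-trapSpace : ∀ {Step} → (∀ I → C I → TrapSpace Step I) → TrapSpace Step ⋀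
    ⋀-trapSpace trap =
        (J₀ , ∈[_]⇒∈[⋀] J₀∈C)
      , λ J J∈⋀ K step → ∈[_]⇒∈[⋀] λ I CI → proj₂ (trap I CI) J (∈[⋀]⇒∈[_] J∈⋀ I CI) K step

  uniqueMinimalTrapSpace : ExcludedMiddle → (Step : Interp L → Interp L → Set) (S : InterpSet L) →
                           Σ (Interp L) S → UniqueMinimal L (λ I → TrapSpace Step I × _⊆[_] L S I)
  uniqueMinimalTrapSpace em Step S (J₀ , J₀∈S) =
    least⇒uniqueMinimal C ⋀ (⋀-trapSpace (λ I → proj₁) , S⊆⋀) ⋀-≤s
    where
    C : Interp3 L → Set
    C I = TrapSpace Step I × _⊆[_] L S I
    open Meet em C J₀ (λ I CI → proj₂ CI J₀ J₀∈S)
    S⊆⋀ : _⊆[_] L S ⋀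
    S⊆⋀ J J∈S = ∈[_]⇒∈[⋀] λ I CI → proj₂ CI J J∈S

proposition3p2 : ExcludedMiddle → (L : Signature) (P : Program L) (S : InterpSet L) →
    Σ (Interp L) S →
    UniqueMinimal L (λ I → StableTrapSpace L P I × _⊆[_] L S I) ×
    UniqueMinimal L (λ I → SupportedTrapSpace L P I × _⊆[_] L S I)
proposition3p2 em L P S s₀ =
  uniqueMinimalTrapSpace L em (IsF L P) S s₀ , uniqueMinimalTrapSpace L em (IsT L P) S s₀
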